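{- Let $G$ be a graph with no isolated vertex and let $H$ be a graph (with no isolated vertex) such that $\gamma_t(H)=\gamma(H)$. Then: (i) for any TRDF $f$ on $G$ of weight $\gamma_{tR}(G)$, with $V_2=\{x\in V(G): f(x)=2\}$, we have $\gamma_{R}(G\times H)\leq 2\gamma(H)(\gamma_{tR}(G)-|V_2|)$; (ii) if there exists a TRDF $f$ on $G$ of weight $\gamma_{tR}(G)$ such that $V_2=\{x: f(x)=2\}$ is a dominating set of $G$, then $\gamma_{R}(G\times H)\leq 2\gamma(H)(\gamma_{tR}(G)-\gamma(G))$.
   Context: All graphs are finite and simple. The direct product $G\times H$ has vertex set $V(G)\times V(H)$, with $(u,v)$ adjacent to $(u',v')$ iff $uu'\in E(G)$ and $vv'\in E(H)$. A set $S$ is dominating if every vertex is in $S$ or adjacent to a vertex of $S$; $\gamma(G)$ is the minimum size of a dominating set. A set $D$ is total dominating if every vertex of $G$ has a neighbor in $D$; $\gamma_t(G)$ is the minimum size of a total dominating set. For $f:V(G)\to\{0,1,2\}$ write $V_i=\{v:f(v)=i\}$ and $\omega(f)=|V_1|+2|V_2|$. $f$ is a Roman dominating function (RDF) if every vertex in $V_0$ has a neighbor in $V_2$; $\gamma_R(G)$ is the minimum weight of an RDF. An RDF is a total Roman dominating function (TRDF) if the subgraph induced by $V_1\cup V_2$ has no isolated vertices; $\gamma_{tR}(G)$ is the minimum weight of a TRDF. -}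

module Defs where

open import Data.Nat using (ℕ; _≤_; _*_)
open import Data.Nat.Base using (_≡ᵇ_)
open import Data.Bool using (Bool; true; false; _∧_)
open import Data.Fin using (Fin; toℕ; remQuot)
open import Data.Fin.Subset using (Subset; _∈_; ∣_∣)
open import Data.Vec using (tabulate)
open import Data.List using (map; allFin)
open import Data.Nat.ListAction using (sum)
open import Data.Product using (Σ; ∃; _×_; _,_; proj₁; proj₂)
open import Data.Sum using (_⊎_)
open import Relation.Binary.PropositionalEquality using (_≡_; _≢_)

Adj : ℕ → Set
Adj n = Fin n → Fin n → Bool

record Simple {n : ℕ} (A : Adj n) : Set where
  field
    sym    : ∀ u v → A u v ≡ A v u
    irrefl : ∀ v → A v v ≡ false

NoIsolated : ∀ {n} → Adj n → Set
NoIsolated {n} A = ∀ (v : Fin n) → ∃ λ u → A v u ≡ true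

-- Direct product G × H on vertex set Fin (n * m) ≅ Fin n × Fin m (via remQuot).
_×ᵍ_ : ∀ {n m} → Adj n → Adj m → Adj (n * m)
_×ᵍ_ {n} {m} G H i j =
  G (proj₁ (remQuot {n} m i)) (proj₁ (remQuot {n} m j)) ∧ H (proj₂ (remQuot {n} m i)) (proj₂ (remQuot {n} m j))

Dominating : ∀ {n} → Adj n → Subset n → Set
Dominating {n} A S = ∀ (v : Fin n) → v ∈ S ⊎ (∃ λ u → u ∈ S × A v u ≡ true)

TotalDominating : ∀ {n} → Adj n → Subset n → Set
TotalDominating {n} A S = ∀ (v : Fin n) → ∃ λ u → u ∈ S × A v u ≡ true

IsMinCard : ∀ {n} → (Subset n → Set) → ℕ → Set
IsMinCard {n} P k = (Σ (Subset n) λ S → P S × ∣ S ∣ ≡ k) × (∀ S → P S → k ≤ ∣ S ∣)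

IsDomNumber : ∀ {n} → Adj n → ℕ → Set
IsDomNumber A = IsMinCard (Dominating A)

IsTotDomNumber : ∀ {n} → Adj n → ℕ → Set
IsTotDomNumber A = IsMinCard (TotalDominating A)

Labelling : ℕ → Set
Labelling n = Fin n → Fin 3

weight : ∀ {n} → Labelling n → ℕ
weight {n} f = sum (map (λ v → toℕ (f v)) (allFin n))

V₂ : ∀ {n} → Labelling n → Subset n
V₂ f = tabulate (λ v → toℕ (f v) ≡ᵇ 2)

RDF : ∀ {n} → Adj n → Labelling n → Set
RDF {n} A f = ∀ (v : Fin n) → toℕ (f v) ≡ 0 → ∃ λ u → A v u ≡ true × toℕ (f u) ≡ 2

-- RDF such that the subgraph induced by V₁ ∪ V₂ has no isolated vertex.
TRDF : ∀ {n} → Adj n → Labelling n → Set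
TRDF {n} A f = RDF A f ×
  (∀ (v : Fin n) → toℕ (f v) ≢ 0 → ∃ λ u → A v u ≡ true × toℕ (f u) ≢ 0)

IsMinWeight : ∀ {n} → (Labelling n → Set) → ℕ → Set
IsMinWeight {n} P k = (Σ (Labelling n) λ f → P f × weight f ≡ k) × (∀ f → P f → k ≤ weight f)

IsRomanNumber : ∀ {n} → Adj n → ℕ → Set
IsRomanNumber A = IsMinWeight (RDF A)

IsTotRomanNumber : ∀ {n} → Adj n → ℕ → Set
IsTotRomanNumber A = IsMinWeight (TRDF A)

-- Take a minimum total dominating set D of H, so ∣ D ∣ = γ_t(H) = γ(H), and let f be a
-- minimum TRDF of G. The support V₁ ∪ V₂ of f totally dominates G: a vertex labelled 0
-- sees a 2, any other vertex sees a non-zero label. Total domination is preserved by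
-- the direct product, so (V₁ ∪ V₂) × D totally dominates G × H and labelling it by 2
-- gives an RDF of weight 2 ∣ V₁ ∪ V₂ ∣ ∣ D ∣ = 2 γ(H) (γ_tR(G) − ∣ V₂ ∣).
-- For (ii), V₂ dominating G gives ∣ V₂ ∣ ≥ γ(G).
module Submission where

open import Defs
open import Data.Bool using (Bool; true; false; _∧_; if_then_else_)
open import Data.Fin using (Fin; zero; suc; toℕ; fromℕ; remQuot; combine; _↑ˡ_; _↑ʳ_)
open import Data.Fin.Properties using (remQuot-combine)
open import Data.Fin.Subset using (Subset; _∈_; ∣_∣)
import Data.List as List
open import Data.List.Properties using (map-tabulate)
open import Data.Nat.ListAction using () renaming (sum to sumₗ)
open import Data.Nat using (ℕ; _+_; _*_; _∸_; _≤_; _≟_)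
open import Data.Nat.Base using (_≡ᵇ_)
open import Data.Nat.Properties
  using (+-*-semiring; +-assoc; *-assoc; *-comm; *-identityˡ; m+n∸n≡m; ≤-trans; ≤-reflexive;
         *-monoʳ-≤; ∸-monoʳ-≤)
open import Algebra.Properties.Semiring.Sum +-*-semiring
  using (sum-syntax; sum-cong-≗; ∑-distrib-+; *-distribˡ-sum; *-distribʳ-sum)
open import Data.Product using (Σ; _×_; _,_; proj₁; proj₂)
open import Data.Vec using (tabulate; lookup)
open import Data.Vec.Properties using ([]=⇒lookup; lookup⇒[]=; lookup∘tabulate; tabulate∘lookup)
open import Function using (_∘_; id)
open import Relation.Nullary using (yes; no; contradiction)
open import Relation.Binary.PropositionalEquality
open ≡-Reasoning

sum-tabulate : ∀ {n} (h : Fin n → ℕ) → sumₗ (List.tabulate h) ≡ ∑[ i < n ] h i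
sum-tabulate {ℕ.zero} h = refl
sum-tabulate {ℕ.suc n} h = cong (h zero +_) (sum-tabulate (h ∘ suc))

weight≡∑ : ∀ {n} (f : Labelling n) → weight f ≡ ∑[ v < n ] toℕ (f v)
weight≡∑ f = trans (cong sumₗ (map-tabulate id (toℕ ∘ f))) (sum-tabulate (toℕ ∘ f))

∑-↑ : ∀ a b (h : Fin (a + b) → ℕ) →
  ∑[ k < a + b ] h k ≡ ∑[ i < a ] h (i ↑ˡ b) + ∑[ j < b ] h (a ↑ʳ j)
∑-↑ ℕ.zero b h = refl
∑-↑ (ℕ.suc a) b h = begin
  h zero + ∑[ k < a + b ] h (suc k)
    ≡⟨ cong (h zero +_) (∑-↑ a b (h ∘ suc)) ⟩
  h zero + (∑[ i < a ] h (suc (i ↑ˡ b)) + ∑[ j < b ] h (suc (a ↑ʳ j)))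
    ≡⟨ +-assoc (h zero) _ _ ⟨
  h zero + ∑[ i < a ] h (suc (i ↑ˡ b)) + ∑[ j < b ] h (suc (a ↑ʳ j)) ∎

∑-combine : ∀ n m (h : Fin (n * m) → ℕ) →
  ∑[ k < n * m ] h k ≡ ∑[ x < n ] ∑[ y < m ] h (combine x y)
∑-combine ℕ.zero m h = refl
∑-combine (ℕ.suc n) m h =
  trans (∑-↑ m (n * m) h) (cong (∑[ j < m ] h (j ↑ˡ (n * m)) +_) (∑-combine n m (h ∘ (m ↑ʳ_))))

indicator : Bool → ℕ
indicator true = 1
indicator false = 0

indicator-∧ : ∀ a b → indicator (a ∧ b) ≡ indicator a * indicator b
indicator-∧ true b = sym (*-identityˡ (indicator b))
indicator-∧ false b = refl

∣tabulate∣≡∑ : ∀ {n} (p : Fin n → Bool) → ∣ tabulate p ∣ ≡ ∑[ i < n ] indicator (p i)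
∣tabulate∣≡∑ {ℕ.zero} p = refl
∣tabulate∣≡∑ {ℕ.suc n} p with p zero
... | true = cong ℕ.suc (∣tabulate∣≡∑ (p ∘ suc))
... | false = ∣tabulate∣≡∑ (p ∘ suc)

∣p∣≡∑ : ∀ {n} (p : Subset n) → ∣ p ∣ ≡ ∑[ i < n ] indicator (lookup p i)
∣p∣≡∑ p = trans (cong ∣_∣ (sym (tabulate∘lookup p))) (∣tabulate∣≡∑ (lookup p))

∈-tabulate⁺ : ∀ {n} {p : Fin n → Bool} {i} → p i ≡ true → i ∈ tabulate p
∈-tabulate⁺ {p = p} {i} pi = lookup⇒[]= i (tabulate p) (trans (lookup∘tabulate p i) pi)

_⊠_ : ∀ {n m} → Subset n → Subset m → Subset (n * m)
_⊠_ {n} {m} A B = tabulate λ k →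
  lookup A (proj₁ (remQuot {n} m k)) ∧ lookup B (proj₂ (remQuot {n} m k))

∣⊠∣ : ∀ {n m} (A : Subset n) (B : Subset m) → ∣ A ⊠ B ∣ ≡ ∣ A ∣ * ∣ B ∣
∣⊠∣ {n} {m} A B = begin
  ∣ A ⊠ B ∣
    ≡⟨ trans (∣tabulate∣≡∑ (inAB ∘ remQuot {n} m)) (∑-combine n m (indicator ∘ inAB ∘ remQuot {n} m)) ⟩
  ∑[ x < n ] ∑[ y < m ] indicator (inAB (remQuot {n} m (combine x y)))
    ≡⟨ sum-cong-≗ (λ x → sum-cong-≗ λ y → cong (indicator ∘ inAB) (remQuot-combine x y)) ⟩
  ∑[ x < n ] ∑[ y < m ] indicator (lookup A x ∧ lookup B y)
    ≡⟨ sum-cong-≗ (λ x → sum-cong-≗ λ y → indicator-∧ (lookup A x) (lookup B y)) ⟩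
  ∑[ x < n ] ∑[ y < m ] (a x * b y)
    ≡⟨ sum-cong-≗ (λ x → *-distribˡ-sum (a x) b) ⟨
  ∑[ x < n ] (a x * ∑[ y < m ] b y)
    ≡⟨ *-distribʳ-sum (∑[ y < m ] b y) a ⟨
  ∑[ x < n ] a x * ∑[ y < m ] b y
    ≡⟨ cong₂ _*_ (∣p∣≡∑ A) (∣p∣≡∑ B) ⟨
  ∣ A ∣ * ∣ B ∣ ∎
  where
  inAB : Fin n × Fin m → Bool
  inAB (x , y) = lookup A x ∧ lookup B y
  a : Fin n → ℕ
  a = indicator ∘ lookup A
  b : Fin m → ℕ
  b = indicator ∘ lookup B

combine-∈-⊠ : ∀ {n m} {A : Subset n} {B : Subset m} {x y} →
  x ∈ A → y ∈ B → combine x y ∈ A ⊠ B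
combine-∈-⊠ {n} {m} {A} {B} {x} {y} x∈A y∈B = ∈-tabulate⁺ (begin
  lookup A (proj₁ (remQuot {n} m (combine x y))) ∧ lookup B (proj₂ (remQuot {n} m (combine x y)))
    ≡⟨ cong (λ (p : Fin n × Fin m) → lookup A (proj₁ p) ∧ lookup B (proj₂ p)) (remQuot-combine x y) ⟩
  lookup A x ∧ lookup B y
    ≡⟨ cong₂ _∧_ ([]=⇒lookup x∈A) ([]=⇒lookup y∈B) ⟩
  true ∎)

×ᵍ-combine : ∀ {n m} (G : Adj n) (H : Adj m) (v : Fin (n * m)) x y →
  (G ×ᵍ H) v (combine x y) ≡ G (proj₁ (remQuot {n} m v)) x ∧ H (proj₂ (remQuot {n} m v)) y
×ᵍ-combine {n} {m} G H v x y =
  cong (λ (p : Fin n × Fin m) → G (proj₁ (remQuot {n} m v)) (proj₁ p) ∧ H (proj₂ (remQuot {n} m v)) (proj₂ p))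
       (remQuot-combine x y)

⊠-totalDominating : ∀ {n m} {G : Adj n} {H : Adj m} {A B} →
  TotalDominating G A → TotalDominating H B → TotalDominating (G ×ᵍ H) (A ⊠ B)
⊠-totalDominating {n} {m} {G} {H} tdA tdB v
  with tdA (proj₁ (remQuot {n} m v)) | tdB (proj₂ (remQuot {n} m v))
... | x , x∈A , Gxx | y , y∈B , Hyy =
  combine x y , combine-∈-⊠ x∈A y∈B , trans (×ᵍ-combine G H v x y) (cong₂ _∧_ Gxx Hyy)

twoOn : ∀ {n} → Subset n → Labelling n
twoOn S v = if lookup S v then fromℕ 2 else zero

toℕ-twoOn : ∀ {n} (S : Subset n) v → toℕ (twoOn S v) ≡ 2 * indicator (lookup S v)
toℕ-twoOn S v with lookup S v
... | true = refl
... | false = refl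

weight-twoOn : ∀ {n} (S : Subset n) → weight (twoOn S) ≡ 2 * ∣ S ∣
weight-twoOn {n} S = begin
  weight (twoOn S)                          ≡⟨ weight≡∑ (twoOn S) ⟩
  ∑[ v < n ] toℕ (twoOn S v)                ≡⟨ sum-cong-≗ (toℕ-twoOn S) ⟩
  ∑[ v < n ] (2 * indicator (lookup S v))   ≡⟨ *-distribˡ-sum 2 (indicator ∘ lookup S) ⟨
  2 * ∑[ v < n ] indicator (lookup S v)     ≡⟨ cong (2 *_) (∣p∣≡∑ S) ⟨
  2 * ∣ S ∣                                 ∎

totalDominating⇒RDF-twoOn : ∀ {n} {A : Adj n} {S} → TotalDominating A S → RDF A (twoOn S)
totalDominating⇒RDF-twoOn {S = S} td v _ with td v
... | u , u∈S , Avu = u , Avu , cong (λ b → toℕ (if b then fromℕ 2 else zero)) ([]=⇒lookup u∈S)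

positive : Fin 3 → Bool
positive zero = false
positive (suc _) = true

support : ∀ {n} → Labelling n → Subset n
support f = tabulate (positive ∘ f)

positive-≢0 : ∀ a → toℕ a ≢ 0 → positive a ≡ true
positive-≢0 zero a≢0 = contradiction refl a≢0
positive-≢0 (suc _) _ = refl

≡2⇒≢0 : ∀ {k} → k ≡ 2 → k ≢ 0
≡2⇒≢0 refl ()

TRDF⇒support-totalDominating : ∀ {n} {A : Adj n} {f} → TRDF A f → TotalDominating A (support f)
TRDF⇒support-totalDominating {f = f} (rdf , supportNoIsolated) v with toℕ (f v) ≟ 0
... | yes fv≡0 = let u , Avu , fu≡2 = rdf v fv≡0 in
  u , ∈-tabulate⁺ (positive-≢0 (f u) (≡2⇒≢0 fu≡2)) , Avu
... | no fv≢0 = let u , Avu , fu≢0 = supportNoIsolated v fv≢0 in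
  u , ∈-tabulate⁺ (positive-≢0 (f u) fu≢0) , Avu

weight≡∣support∣+∣V₂∣ : ∀ {n} (f : Labelling n) → weight f ≡ ∣ support f ∣ + ∣ V₂ f ∣
weight≡∣support∣+∣V₂∣ {n} f = begin
  weight f
    ≡⟨ weight≡∑ f ⟩
  ∑[ v < n ] toℕ (f v)
    ≡⟨ sum-cong-≗ (split ∘ f) ⟩
  ∑[ v < n ] (indicator (positive (f v)) + indicator (toℕ (f v) ≡ᵇ 2))
    ≡⟨ ∑-distrib-+ (indicator ∘ positive ∘ f) (λ v → indicator (toℕ (f v) ≡ᵇ 2)) ⟩
  ∑[ v < n ] indicator (positive (f v)) + ∑[ v < n ] indicator (toℕ (f v) ≡ᵇ 2)
    ≡⟨ cong₂ _+_ (∣tabulate∣≡∑ (positive ∘ f)) (∣tabulate∣≡∑ (λ v → toℕ (f v) ≡ᵇ 2)) ⟨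
  ∣ support f ∣ + ∣ V₂ f ∣ ∎
  where
  split : ∀ a → toℕ a ≡ indicator (positive a) + indicator (toℕ a ≡ᵇ 2)
  split zero = refl
  split (suc zero) = refl
  split (suc (suc zero)) = refl

theorem2p3 : ∀ {n m} (G : Adj n) (H : Adj m) →
    Simple G → Simple H → NoIsolated G → NoIsolated H →
    ∀ (γtH γH γtRG γG γRGH : ℕ) →
    IsTotDomNumber H γtH → IsDomNumber H γH → γtH ≡ γH →
    IsTotRomanNumber G γtRG → IsDomNumber G γG → IsRomanNumber (G ×ᵍ H) γRGH →
    (∀ (f : Labelling n) → TRDF G f → weight f ≡ γtRG →
      γRGH ≤ 2 * γH * (γtRG ∸ ∣ V₂ f ∣))
    ×
    ((Σ (Labelling n) λ f → TRDF G f × weight f ≡ γtRG × Dominating G (V₂ f)) →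
      γRGH ≤ 2 * γH * (γtRG ∸ γG))
theorem2p3 {n} {m} G H _ _ _ _ γtH γH γtRG γG γRGH
  ((D , tdD , ∣D∣≡γtH) , _) _ γtH≡γH _ (_ , minDomG) (_ , minRomanGH) = part-i , part-ii
  where
  part-i : ∀ (f : Labelling n) → TRDF G f → weight f ≡ γtRG →
    γRGH ≤ 2 * γH * (γtRG ∸ ∣ V₂ f ∣)
  part-i f trdf wf≡γtRG = ≤-trans (minRomanGH g rdf) (≤-reflexive (begin
    weight g                          ≡⟨ weight-twoOn (support f ⊠ D) ⟩
    2 * ∣ support f ⊠ D ∣             ≡⟨ cong (2 *_) (trans (∣⊠∣ (support f) D) (*-comm _ ∣ D ∣)) ⟩
    2 * (∣ D ∣ * ∣ support f ∣)       ≡⟨ *-assoc 2 ∣ D ∣ _ ⟨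
    2 * ∣ D ∣ * ∣ support f ∣         ≡⟨ cong₂ (λ d s → 2 * d * s) (trans ∣D∣≡γtH γtH≡γH) ∣support∣≡ ⟩
    2 * γH * (γtRG ∸ ∣ V₂ f ∣)        ∎))
    where
    g : Labelling (n * m)
    g = twoOn (support f ⊠ D)
    rdf : RDF (G ×ᵍ H) g
    rdf = totalDominating⇒RDF-twoOn (⊠-totalDominating (TRDF⇒support-totalDominating trdf) tdD)
    ∣support∣≡ : ∣ support f ∣ ≡ γtRG ∸ ∣ V₂ f ∣
    ∣support∣≡ = begin
      ∣ support f ∣                          ≡⟨ m+n∸n≡m _ ∣ V₂ f ∣ ⟨
      ∣ support f ∣ + ∣ V₂ f ∣ ∸ ∣ V₂ f ∣    ≡⟨ cong (_∸ ∣ V₂ f ∣) (trans (sym (weight≡∣support∣+∣V₂∣ f)) wf≡γtRG) ⟩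
      γtRG ∸ ∣ V₂ f ∣                        ∎

  part-ii : (Σ (Labelling n) λ f → TRDF G f × weight f ≡ γtRG × Dominating G (V₂ f)) →
    γRGH ≤ 2 * γH * (γtRG ∸ γG)
  part-ii (f , trdf , wf≡γtRG , domV₂) =
    ≤-trans (part-i f trdf wf≡γtRG) (*-monoʳ-≤ (2 * γH) (∸-monoʳ-≤ γtRG (minDomG (V₂ f) domV₂)))
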